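{- Let $\Gamma=(U\cup V,E)$ be a $3$-regular bipartite graph with bipartition $U,V$, let $m=|U|$, and let $\hat\Gamma$ be its CFI graph. For any $2$-factor $F\subseteq E$ of $\Gamma$ and any function $f:F\to\{0,1\}$, the set $\mu(F,f)$ contains exactly $2^{2m}$ perfect matchings.
   Context: CFI graph $\hat\Gamma$: for each vertex $v$ of $\Gamma$ with neighbour set $N(v)$ (of size 3), introduce a set $I_v$ of four inner vertices $v_S$, one for each $S\subseteq N(v)$ of even size, and a set $O_v$ of six outer vertices $(v,u,0),(v,u,1)$ for $u\in N(v)$; add an edge between $v_S$ and $(v,u,1)$ if $u\in S$ and between $v_S$ and $(v,u,0)$ if $u\notin S$. For each edge $e=\{u,v\}\in E$ add two edges: $e_0$ joining $(v,u,0)$ and $(u,v,0)$, and $e_1$ joining $(v,u,1)$ and $(u,v,1)$. A $2$-factor of $\Gamma$ is a set $F\subseteq E$ such that every vertex of $\Gamma$ is incident to exactly two edges of $F$. A perfect matching of $\hat\Gamma$ is uniform if for every $e\in E$ at most one of $e_0,e_1$ belongs to it. $\mu(F,f)$ denotes the set of uniform perfect matchings $\mu$ of $\hat\Gamma$ such that $\{e\in E : \text{exactly one of } e_0,e_1 \in \mu\}=F$ and, for every $e\in F$, $e_{f(e)}\in\mu$. -}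

module Defs where

open import Data.Nat using (ℕ; _%_)
open import Data.Fin using (Fin; _<_)
open import Data.Fin.Subset using (Subset; _∈_; _⊆_; ∣_∣)
open import Data.Bool using (Bool; true; false; not; _xor_)
open import Data.Vec using (Vec; lookup; tabulate)
open import Data.Product using (Σ; _×_; _,_)
open import Data.Sum using (_⊎_)
open import Data.Empty using (⊥)
open import Relation.Nullary using (¬_)
open import Relation.Binary.PropositionalEquality using (_≡_; _≗_)

record Graph (n : ℕ) : Set where
  field
    adj        : Fin n → Fin n → Bool
    adj-sym    : ∀ u v → adj u v ≡ adj v u
    adj-irrefl : ∀ v → adj v v ≡ false

open Graph public

N : ∀ {n} → Graph n → Fin n → Subset n
N Γ v = tabulate (adj Γ v)

IsCubic : ∀ {n} → Graph n → Set
IsCubic Γ = ∀ v → ∣ N Γ v ∣ ≡ 3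

-- (U , V = complement of U) is a bipartition: every edge has exactly
-- one endpoint in U
IsBipartition : ∀ {n} → Graph n → Subset n → Set
IsBipartition Γ U = ∀ u v → adj Γ u v ≡ true → lookup U u ≡ not (lookup U v)

EdgeSet : ℕ → Set
EdgeSet n = Fin n → Fin n → Bool

IsTwoFactor : ∀ {n} → Graph n → EdgeSet n → Set
IsTwoFactor Γ F =
  (∀ u v → F u v ≡ F v u) ×
  (∀ u v → F u v ≡ true → adj Γ u v ≡ true) ×
  (∀ v → ∣ tabulate (F v) ∣ ≡ 2)

-- The CFI graph Γ̂
-- Candidate vertices (validity is a separate predicate):
--   inner v S   : v_S
--   outer v u b : (v,u,b)

data HVtx (n : ℕ) : Set where
  inner : Fin n → Subset n → HVtx n
  outer : Fin n → Fin n → Bool → HVtx n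

-- Candidate edges:
--   io v S u  : the edge joining v_S and (v,u,[u ∈ S])
--   oo u v b  : the edge e_b for e = {u,v}, joining (v,u,b) and (u,v,b);
--               each edge e of Γ is represented once, with u < v
data HEdge (n : ℕ) : Set where
  io : Fin n → Subset n → Fin n → HEdge n
  oo : Fin n → Fin n → Bool → HEdge n

ValidVtx : ∀ {n} → Graph n → HVtx n → Set
ValidVtx Γ (inner v S)   = (S ⊆ N Γ v) × (∣ S ∣ % 2 ≡ 0)
ValidVtx Γ (outer v u b) = u ∈ N Γ v

ValidEdge : ∀ {n} → Graph n → HEdge n → Set
ValidEdge Γ (io v S u) = ValidVtx Γ (inner v S) × u ∈ N Γ v
ValidEdge Γ (oo u v b) = (u < v) × (adj Γ u v ≡ true)

-- incidence between a vertex and an edge of Γ̂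
-- (lookup S u is the bit [u ∈ S], true = 1)
Inc : ∀ {n} → HVtx n → HEdge n → Set
Inc (inner v S)   (io v' S' u)  = (v ≡ v') × (S ≡ S')
Inc (inner v S)   (oo x y b)    = ⊥
Inc (outer v u b) (io v' S u')  = (v ≡ v') × (u ≡ u') × (lookup S u ≡ b)
Inc (outer v u b) (oo x y b')   = (b ≡ b') × (((v ≡ x) × (u ≡ y)) ⊎ ((v ≡ y) × (u ≡ x)))

EdgeSubset : ℕ → Set
EdgeSubset n = HEdge n → Bool

IsPerfectMatching : ∀ {n} → Graph n → EdgeSubset n → Set
IsPerfectMatching Γ M =
  (∀ e → M e ≡ true → ValidEdge Γ e) ×
  (∀ x → ValidVtx Γ x →
     Σ (HEdge _) λ e → (M e ≡ true) × Inc x e ×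
       (∀ e' → M e' ≡ true → Inc x e' → e' ≡ e))

IsUniform : ∀ {n} → Graph n → EdgeSubset n → Set
IsUniform Γ M = ∀ u v → u < v → adj Γ u v ≡ true →
  ¬ ((M (oo u v false) ≡ true) × (M (oo u v true) ≡ true))

-- μ(F,f): f(e) for e = {u,v} with u < v is read as f u v
InMu : ∀ {n} → Graph n → EdgeSet n → (Fin n → Fin n → Bool) → EdgeSubset n → Set
InMu Γ F f M =
  IsPerfectMatching Γ M × IsUniform Γ M ×
  (∀ u v → u < v → adj Γ u v ≡ true →
     ((M (oo u v false) xor M (oo u v true) ≡ true) → F u v ≡ true) ×
     (F u v ≡ true → (M (oo u v false) xor M (oo u v true) ≡ true))) ×
  (∀ u v → u < v → F u v ≡ true → M (oo u v (f u v)) ≡ true)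

HasExactly : {A : Set} → (A → A → Set) → (A → Set) → ℕ → Set
HasExactly {A} _≈_ P k =
  Σ (Vec A k) λ L →
    (∀ i → P (lookup L i)) ×
    (∀ x → P x → Σ (Fin k) λ i → x ≈ lookup L i) ×
    (∀ i j → lookup L i ≈ lookup L j → i ≡ j)

-- At an edge e = {u,v} of F the copy e_{f(e)} lies in the matching and e_{1-f(e)} does not; at an
-- edge outside F neither copy does.  So the outer–outer part of a matching in μ(F,f) is fixed,
-- and at each vertex v what remains is a perfect matching between the four inner vertices v_S
-- and the four outer vertices of v not covered by those copies.  In this local graph the inner
-- vertex missing both free outer vertices of the F-neighbours has a single neighbour, and
-- removing that forced edge leaves a 6-cycle, which has exactly two perfect matchings.  The
-- choices at different vertices are independent, so μ(F,f) is in bijection with the Boolean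
-- functions on the n vertices of Γ; double counting the edges of the cubic bipartite graph
-- gives n = 2|U|.
module Submission where

open import Defs
open import Data.Nat using (ℕ; zero; suc; _+_; _*_; _^_; _∸_; _%_)
open import Data.Nat.Properties
  using (+-*-semiring; +-assoc; +-comm; +-suc; +-identityʳ; *-cancelʳ-≡; m+[n∸m]≡n; suc-injective)
open import Data.Fin using (Fin; zero; suc; _<_; _<?_; _≟_; combine; finToFun; funToFin)
open import Data.Fin.Patterns using (0F; 1F; 2F)
open import Data.Fin.Properties using (any?; <-asym; <-cmp; 0≢1+n; funToFin-finToFin; finToFun-funToFin)
import Data.Fin.Properties as Fin
import Data.Nat as ℕ using (_≟_)
open import Data.Fin.Subset using (Subset; _∈_; _⊆_; ∣_∣; ∁)
open import Data.Fin.Subset.Properties using (_∈?_; _⊆?_; ∣∁p∣≡n∸∣p∣; ∣p∣≤n)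
open import Data.Bool using (Bool; true; false; not; _∧_; _xor_; if_then_else_)
open import Data.Bool.Properties using (∧-zeroʳ; ∧-identityʳ; xor-assoc; xor-same; xor-identityʳ)
open import Data.Product using (Σ; _×_; _,_; proj₁; proj₂)
open import Data.Sum using (inj₁; inj₂)
open import Data.Empty using (⊥-elim)
open import Data.Vec using ([]; _∷_; tabulate; lookup; here; there)
open import Data.Vec.Properties
  using (lookup∘tabulate; tabulate∘lookup; tabulate-cong; []=⇒lookup; lookup⇒[]=; lookup-map)
open import Function using (_∘_)
open import Relation.Binary using (tri<; tri≈; tri>)
open import Relation.Nullary using (Dec; yes; no; does; ¬_)
open import Relation.Nullary.Decidable using (dec-true; dec-false; _×-dec_)
open import Relation.Binary.PropositionalEquality
open import Algebra.Properties.Semiring.Sum +-*-semiring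
  using (sum-syntax; ∑-comm; *-distribʳ-sum; sum-cong-≗; sum-replicate-zero)

∧-elim : ∀ {x y} → x ∧ y ≡ true → x ≡ true × y ≡ true
∧-elim {true} y = refl , y

∧-intro : ∀ {x y} → x ≡ true → y ≡ true → x ∧ y ≡ true
∧-intro refl y = y

bool-clash : ∀ {A : Set} {b} → b ≡ false → b ≡ true → A
bool-clash refl ()

from-does : ∀ {A : Set} (d : Dec A) → does d ≡ true → A
from-does (yes a) _ = a

_⇒ᵇ_ : Bool → Bool → Bool
true  ⇒ᵇ b = b
false ⇒ᵇ _ = true

⇒ᵇ-mp : ∀ {a b} → a ⇒ᵇ b ≡ true → a ≡ true → b ≡ true
⇒ᵇ-mp h refl = h

_≡ᵇ_ : Bool → Bool → Bool
a ≡ᵇ b = not (a xor b)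

≡ᵇ-sound : ∀ {a b} → a ≡ᵇ b ≡ true → a ≡ b
≡ᵇ-sound {true}  {true}  _ = refl
≡ᵇ-sound {false} {false} _ = refl

xor-cancelʳ : ∀ a b → (a xor b) xor b ≡ a
xor-cancelʳ a b = trans (xor-assoc a b b) (trans (cong (a xor_) (xor-same b)) (xor-identityʳ a))

xor-select : ∀ m₀ m₁ c b → m₀ xor m₁ ≡ true → (if c then m₁ else m₀) ≡ true →
  (if b then m₁ else m₀) ≡ (b ≡ᵇ c)
xor-select true  false false false _ _ = refl
xor-select true  false false true  _ _ = refl
xor-select false true  true  false _ _ = refl
xor-select false true  true  true  _ _ = refl

xor-neither : ∀ m₀ m₁ b → ¬ (m₀ xor m₁ ≡ true) → ¬ (m₀ ≡ true × m₁ ≡ true) →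
  (if b then m₁ else m₀) ≡ false
xor-neither false false true  _    _     = refl
xor-neither false false false _    _     = refl
xor-neither true  true  _     _    ¬both = ⊥-elim (¬both (refl , refl))
xor-neither true  false _     ¬one _     = ⊥-elim (¬one refl)
xor-neither false true  _     ¬one _     = ⊥-elim (¬one refl)

BoolFun : ℕ → Set
BoolFun zero    = Bool
BoolFun (suc k) = Bool → BoolFun k

Holds : ∀ k → BoolFun k → Set
Holds zero    b = b ≡ true
Holds (suc k) g = ∀ x → Holds k (g x)

tautology? : ∀ k → BoolFun k → Bool
tautology? zero    b = b
tautology? (suc k) g = tautology? k (g true) ∧ tautology? k (g false)

tautology-sound : ∀ k (g : BoolFun k) → tautology? k g ≡ true → Holds k g
tautology-sound zero    b h       = h
tautology-sound (suc k) g h true  = tautology-sound k (g true) (proj₁ (∧-elim {tautology? k (g true)} h))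
tautology-sound (suc k) g h false = tautology-sound k (g false) (proj₂ (∧-elim {tautology? k (g true)} h))

exactlyOne : Bool → Bool → Bool → Bool
exactlyOne true  b c = not b ∧ not c
exactlyOne false b c = b xor c

Unique : (Fin 3 → Bool) → Fin 3 → Set
Unique g i = g i ≡ true × (∀ j → g j ≡ true → j ≡ i)

Unique⇒false : ∀ {g i} → Unique g i → ∀ j → j ≢ i → g j ≡ false
Unique⇒false {g} (_ , only) j j≢i with g j in gj
... | true  = ⊥-elim (j≢i (only j gj))
... | false = refl

exactlyOne-sound : ∀ g → exactlyOne (g 0F) (g 1F) (g 2F) ≡ true → Σ (Fin 3) (Unique g)
exactlyOne-sound g one with g 0F in g₀ | g 1F in g₁ | g 2F in g₂
... | true  | false | false = 0F , g₀ , λ { 0F _ → refl ; 1F e → bool-clash g₁ e ; 2F e → bool-clash g₂ e }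
... | false | true  | false = 1F , g₁ , λ { 0F e → bool-clash g₀ e ; 1F _ → refl ; 2F e → bool-clash g₂ e }
... | false | false | true  = 2F , g₂ , λ { 0F e → bool-clash g₀ e ; 1F e → bool-clash g₁ e ; 2F _ → refl }

exactlyOne-complete : ∀ g i → Unique g i → exactlyOne (g 0F) (g 1F) (g 2F) ≡ true
exactlyOne-complete g 0F u@(g₀ , _) rewrite g₀ | Unique⇒false u 1F (λ ()) | Unique⇒false u 2F (λ ()) = refl
exactlyOne-complete g 1F u@(g₁ , _) rewrite Unique⇒false u 0F (λ ()) | g₁ | Unique⇒false u 2F (λ ()) = refl
exactlyOne-complete g 2F u@(g₂ , _) rewrite Unique⇒false u 0F (λ ()) | Unique⇒false u 1F (λ ()) | g₂ = refl

-- The gadget of a vertex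

-- Slots 0F and 1F of a vertex are its two edges in the 2-factor, slot 2F its third edge.
Slot : Set
Slot = Fin 3

allBool : (Bool → Bool) → Bool
allBool P = P true ∧ P false

allSlot : (Slot → Bool) → Bool
allSlot P = P 0F ∧ P 1F ∧ P 2F

allBool-sound : ∀ P → allBool P ≡ true → ∀ b → P b ≡ true
allBool-sound P h true  = proj₁ (∧-elim {P true} h)
allBool-sound P h false = proj₂ (∧-elim {P true} h)

allBool-complete : ∀ P → (∀ b → P b ≡ true) → allBool P ≡ true
allBool-complete P h = ∧-intro (h true) (h false)

allSlot-sound : ∀ P → allSlot P ≡ true → ∀ k → P k ≡ true
allSlot-sound P h 0F = proj₁ (∧-elim {P 0F} h)
allSlot-sound P h 1F = proj₁ (∧-elim {P 1F} (proj₂ (∧-elim {P 0F} h)))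
allSlot-sound P h 2F = proj₂ (∧-elim {P 1F} (proj₂ (∧-elim {P 0F} h)))

allSlot-complete : ∀ P → (∀ k → P k ≡ true) → allSlot P ≡ true
allSlot-complete P h = ∧-intro (h 0F) (∧-intro (h 1F) (h 2F))

-- An inner vertex of the gadget has coordinates (α , β): α (resp. β) says whether it is adjacent
-- to the outer vertex at slot 0F (resp. 1F) that no copy of the F-edge covers.  A table t says
-- whether the edge from inner vertex i to its outer neighbour at slot k is matched.  The outer
-- vertex at slot k with coordinate a has the inner neighbours outerNbr k a true and
-- outerNbr k a false, and is covered by a copy of an F-edge iff inTwoFactor k ∧ not a.
Table : Set
Table = Bool × Bool → Slot → Bool

inTwoFactor : Slot → Bool
inTwoFactor 2F = false
inTwoFactor _  = true

outerNbr : Slot → Bool → Bool → Bool × Bool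
outerNbr 0F a s = a , s
outerNbr 1F a s = s , a
outerNbr 2F a s = s , s xor a

outerNbr-injective : ∀ k {a s s'} → outerNbr k a s ≡ outerNbr k a s' → s ≡ s'
outerNbr-injective 0F = cong proj₂
outerNbr-injective 1F = cong proj₁
outerNbr-injective 2F = cong proj₁

innerCond : Table → Bool × Bool → Bool
innerCond t i = exactlyOne (t i 0F) (t i 1F) (t i 2F)

outerCond : Table → Slot → Bool → Bool
outerCond t k a = exactlyOne (inTwoFactor k ∧ not a) (t (outerNbr k a true) k) (t (outerNbr k a false) k)

record IsGadgetMatching (t : Table) : Set where
  field
    at-inner : ∀ i → innerCond t i ≡ true
    at-outer : ∀ k a → outerCond t k a ≡ true

isGadgetMatching? : Table → Bool
isGadgetMatching? t =
  allBool (λ α → allBool λ β → innerCond t (α , β)) ∧ allSlot (λ k → allBool (outerCond t k))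

isGadgetMatching?-complete : ∀ {t} → IsGadgetMatching t → isGadgetMatching? t ≡ true
isGadgetMatching?-complete {t} m = ∧-intro
  (allBool-complete (λ α → allBool λ β → innerCond t (α , β))
    λ α → allBool-complete (λ β → innerCond t (α , β)) λ β → at-inner (α , β))
  (allSlot-complete (λ k → allBool (outerCond t k)) λ k → allBool-complete (outerCond t k) (at-outer k))
  where open IsGadgetMatching m

IsGadgetMatching-resp : ∀ {t t'} → (∀ i k → t i k ≡ t' i k) → IsGadgetMatching t → IsGadgetMatching t'
IsGadgetMatching-resp {t} {t'} t≗t' m = record { at-inner = inner′ ; at-outer = outer′ }
  where
  open IsGadgetMatching m
  inner′ : ∀ i → innerCond t' i ≡ true
  inner′ i rewrite sym (t≗t' i 0F) | sym (t≗t' i 1F) | sym (t≗t' i 2F) = at-inner i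
  outer′ : ∀ k a → outerCond t' k a ≡ true
  outer′ k a rewrite sym (t≗t' (outerNbr k a true) k) | sym (t≗t' (outerNbr k a false) k) = at-outer k a

partner : Bool → Bool × Bool → Slot
partner c (true  , true)  = if c then 1F else 0F
partner c (true  , false) = if c then 0F else 2F
partner c (false , true)  = if c then 2F else 1F
partner _ (false , false) = 2F

gadget : Bool → Table
gadget c i k = does (k ≟ partner c i)

gadget-choice : ∀ c → gadget c (true , true) 1F ≡ c
gadget-choice true  = refl
gadget-choice false = refl

gadget-isGadgetMatching : ∀ c → IsGadgetMatching (gadget c)
gadget-isGadgetMatching c = record
  { at-inner = λ (α , β) → tautology-sound 3 (λ c α β → innerCond (gadget c) (α , β)) refl c α β
  ; at-outer = λ k → tautology-sound 2 (λ c a → outerCond (gadget c) k a)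
                       (allSlot-sound (λ k → tautology? 2 (λ c a → outerCond (gadget c) k a)) refl k) c
  }

slotFun : Bool → Bool → Bool → Slot → Bool
slotFun x _ _ 0F = x
slotFun _ y _ 1F = y
slotFun _ _ z 2F = z

fromEntries : (b₁ b₂ b₃ b₄ b₅ b₆ b₇ b₈ b₉ b₁₀ b₁₁ b₁₂ : Bool) → Table
fromEntries b₁ b₂ b₃ _  _  _  _  _  _  _   _   _   (true  , true)  = slotFun b₁ b₂ b₃
fromEntries _  _  _  b₄ b₅ b₆ _  _  _  _   _   _   (true  , false) = slotFun b₄ b₅ b₆
fromEntries _  _  _  _  _  _  b₇ b₈ b₉ _   _   _   (false , true)  = slotFun b₇ b₈ b₉
fromEntries _  _  _  _  _  _  _  _  _  b₁₀ b₁₁ b₁₂ (false , false) = slotFun b₁₀ b₁₁ b₁₂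

agree? : Table → Table → Bool
agree? t t' = allBool λ α → allBool λ β → allSlot λ k → t (α , β) k ≡ᵇ t' (α , β) k

agree?-sound : ∀ t t' → agree? t t' ≡ true → ∀ i k → t i k ≡ t' i k
agree?-sound t t' h (α , β) k =
  ≡ᵇ-sound (allSlot-sound (λ k → t (α , β) k ≡ᵇ t' (α , β) k)
    (allBool-sound (λ β → allSlot λ k → t (α , β) k ≡ᵇ t' (α , β) k)
      (allBool-sound (λ α → allBool λ β → allSlot λ k → t (α , β) k ≡ᵇ t' (α , β) k) h α) β) k)

-- Both sides of the implication only inspect the twelve entries of t, so instantiating the
-- exhaustive check over fromEntries at those entries yields it for t itself.
gadget-rigid : ∀ t → IsGadgetMatching t → ∀ i k → t i k ≡ gadget (t (true , true) 1F) i k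
gadget-rigid t m = agree?-sound t (gadget (t (true , true) 1F)) (⇒ᵇ-mp rigid (isGadgetMatching?-complete m))
  where
  rigidity? : Table → Bool
  rigidity? t = isGadgetMatching? t ⇒ᵇ agree? t (gadget (t (true , true) 1F))
  rigid : rigidity? t ≡ true
  rigid = tautology-sound 12 (λ b₁ b₂ b₃ b₄ b₅ b₆ b₇ b₈ b₉ b₁₀ b₁₁ b₁₂ →
            rigidity? (fromEntries b₁ b₂ b₃ b₄ b₅ b₆ b₇ b₈ b₉ b₁₀ b₁₁ b₁₂)) refl
    (t (true , true) 0F) (t (true , true) 1F) (t (true , true) 2F)
    (t (true , false) 0F) (t (true , false) 1F) (t (true , false) 2F)
    (t (false , true) 0F) (t (false , true) 1F) (t (false , true) 2F)
    (t (false , false) 0F) (t (false , false) 1F) (t (false , false) 2F)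

⟦_⟧ : Bool → ℕ
⟦ true  ⟧ = 1
⟦ false ⟧ = 0

∣b∷p∣ : ∀ {n} b (p : Subset n) → ∣ b ∷ p ∣ ≡ ⟦ b ⟧ + ∣ p ∣
∣b∷p∣ true  p = refl
∣b∷p∣ false p = refl

∈-tabulate⁻ : ∀ {n} {g : Fin n → Bool} {x} → x ∈ tabulate g → g x ≡ true
∈-tabulate⁻ {g = g} {x} x∈ = trans (sym (lookup∘tabulate g x)) ([]=⇒lookup x∈)

∈-tabulate⁺ : ∀ {n} {g : Fin n → Bool} {x} → g x ≡ true → x ∈ tabulate g
∈-tabulate⁺ {g = g} {x} gx = lookup⇒[]= x (tabulate g) (trans (lookup∘tabulate g x) gx)

∣tabulate∣-cong : ∀ {n} {g h : Fin n → Bool} → (∀ x → g x ≡ h x) → ∣ tabulate g ∣ ≡ ∣ tabulate h ∣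
∣tabulate∣-cong g≗h = cong ∣_∣ (tabulate-cong g≗h)

∣tabulate∣≡0 : ∀ {n} (g : Fin n → Bool) → (∀ x → g x ≡ false) → ∣ tabulate g ∣ ≡ 0
∣tabulate∣≡0 {zero}  g g≡false = refl
∣tabulate∣≡0 {suc n} g g≡false rewrite g≡false zero = ∣tabulate∣≡0 (g ∘ suc) (g≡false ∘ suc)

∣tabulate∣-split : ∀ {n} (g h : Fin n → Bool) →
  ∣ tabulate g ∣ ≡ ∣ tabulate (λ x → g x ∧ h x) ∣ + ∣ tabulate (λ x → g x ∧ not (h x)) ∣
∣tabulate∣-split {zero}  g h = refl
∣tabulate∣-split {suc n} g h with g zero | h zero | ∣tabulate∣-split (g ∘ suc) (h ∘ suc)
... | true  | true  | split = cong suc split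
... | true  | false | split = trans (cong suc split) (sym (+-suc _ _))
... | false | _     | split = split

∣tabulate∣-remove : ∀ {n} (g : Fin n → Bool) x →
  ∣ tabulate g ∣ ≡ ⟦ g x ⟧ + ∣ tabulate (λ y → g y ∧ not (does (y ≟ x))) ∣
∣tabulate∣-remove {suc n} g zero = begin
  ∣ tabulate g ∣
    ≡⟨ ∣b∷p∣ (g zero) (tabulate (g ∘ suc)) ⟩
  ⟦ g zero ⟧ + ∣ tabulate (g ∘ suc) ∣
    ≡⟨ cong₂ (λ b m → ⟦ g zero ⟧ + (⟦ b ⟧ + m)) (sym (∧-zeroʳ (g zero)))
             (∣tabulate∣-cong (λ y → sym (∧-identityʳ (g (suc y))))) ⟩
  ⟦ g zero ⟧ + (⟦ g zero ∧ false ⟧ + ∣ rest ∣)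
    ≡⟨ cong (⟦ g zero ⟧ +_) (sym (∣b∷p∣ (g zero ∧ false) rest)) ⟩
  ⟦ g zero ⟧ + ∣ tabulate (λ y → g y ∧ not (does (y ≟ zero))) ∣ ∎
  where
  open ≡-Reasoning
  rest = tabulate (λ y → g (suc y) ∧ true)
∣tabulate∣-remove {suc n} g (suc x) = begin
  ∣ tabulate g ∣
    ≡⟨ ∣b∷p∣ (g zero) (tabulate (g ∘ suc)) ⟩
  ⟦ g zero ⟧ + ∣ tabulate (g ∘ suc) ∣
    ≡⟨ cong (⟦ g zero ⟧ +_) (∣tabulate∣-remove (g ∘ suc) x) ⟩
  ⟦ g zero ⟧ + (⟦ g (suc x) ⟧ + ∣ rest ∣)
    ≡⟨ sym (+-assoc ⟦ g zero ⟧ _ _) ⟩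
  (⟦ g zero ⟧ + ⟦ g (suc x) ⟧) + ∣ rest ∣
    ≡⟨ cong (_+ ∣ rest ∣) (+-comm ⟦ g zero ⟧ _) ⟩
  (⟦ g (suc x) ⟧ + ⟦ g zero ⟧) + ∣ rest ∣
    ≡⟨ +-assoc ⟦ g (suc x) ⟧ _ _ ⟩
  ⟦ g (suc x) ⟧ + (⟦ g zero ⟧ + ∣ rest ∣)
    ≡⟨ cong (λ b → ⟦ g (suc x) ⟧ + (⟦ b ⟧ + ∣ rest ∣)) (sym (∧-identityʳ (g zero))) ⟩
  ⟦ g (suc x) ⟧ + (⟦ g zero ∧ true ⟧ + ∣ rest ∣)
    ≡⟨ cong (⟦ g (suc x) ⟧ +_) (sym (∣b∷p∣ (g zero ∧ true) rest)) ⟩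
  ⟦ g (suc x) ⟧ + ∣ tabulate (λ y → g y ∧ not (does (y ≟ suc x))) ∣ ∎
  where
  open ≡-Reasoning
  rest = tabulate (λ y → g (suc y) ∧ not (does (y ≟ x)))

∣tabulate∣≡∑ : ∀ {n} (g : Fin n → Bool) → ∣ tabulate g ∣ ≡ ∑[ i < n ] ⟦ g i ⟧
∣tabulate∣≡∑ {zero}  g = refl
∣tabulate∣≡∑ {suc n} g =
  trans (∣b∷p∣ (g zero) (tabulate (g ∘ suc))) (cong (⟦ g zero ⟧ +_) (∣tabulate∣≡∑ (g ∘ suc)))

∣p∣≡∑ : ∀ {n} (p : Subset n) → ∣ p ∣ ≡ ∑[ i < n ] ⟦ lookup p i ⟧
∣p∣≡∑ p = trans (cong ∣_∣ (sym (tabulate∘lookup p))) (∣tabulate∣≡∑ (lookup p))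

∣tabulate∣-image : ∀ {n k} (g : Fin n → Bool) (s : Fin k → Fin n) → (∀ {i j} → s i ≡ s j → i ≡ j) →
  (∀ x → g x ≡ true → Σ (Fin k) λ i → x ≡ s i) → ∣ tabulate g ∣ ≡ ∑[ i < k ] ⟦ g (s i) ⟧
∣tabulate∣-image {k = zero} g s _ support = ∣tabulate∣≡0 g outside
  where
  outside : ∀ x → g x ≡ false
  outside x with g x in gx
  ... | true  with () ← proj₁ (support x gx)
  ... | false = refl
∣tabulate∣-image {k = suc k} g s s-injective support = begin
  ∣ tabulate g ∣
    ≡⟨ ∣tabulate∣-remove g (s zero) ⟩
  ⟦ g (s zero) ⟧ + ∣ tabulate g′ ∣
    ≡⟨ cong (⟦ g (s zero) ⟧ +_) (∣tabulate∣-image g′ (s ∘ suc) (Fin.suc-injective ∘ s-injective) support′) ⟩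
  ⟦ g (s zero) ⟧ + ∑[ i < k ] ⟦ g′ (s (suc i)) ⟧
    ≡⟨ cong (⟦ g (s zero) ⟧ +_) (sum-cong-≗ (cong ⟦_⟧ ∘ g′∘s)) ⟩
  ⟦ g (s zero) ⟧ + ∑[ i < k ] ⟦ g (s (suc i)) ⟧ ∎
  where
  open ≡-Reasoning
  g′ : Fin _ → Bool
  g′ y = g y ∧ not (does (y ≟ s zero))
  g′∘s : ∀ i → g′ (s (suc i)) ≡ g (s (suc i))
  g′∘s i rewrite dec-false (s (suc i) ≟ s zero) (λ e → 0≢1+n (sym (s-injective e))) = ∧-identityʳ _
  support′ : ∀ x → g′ x ≡ true → Σ (Fin k) λ i → x ≡ s (suc i)
  support′ x g′x with x ≟ s zero | support x (proj₁ (∧-elim g′x))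
  ... | no _   | suc i , x≡ = i , x≡
  ... | no x≢  | zero , x≡  with () ← x≢ x≡
  ... | yes x≡ | _          with () ← trans (cong not (sym (dec-true (x ≟ s zero) x≡)))
                                              (proj₂ (∧-elim {g x} g′x))

xor-even : ∀ a b → (⟦ a ⟧ + (⟦ b ⟧ + (⟦ a xor b ⟧ + 0))) % 2 ≡ 0
xor-even true  true  = refl
xor-even true  false = refl
xor-even false true  = refl
xor-even false false = refl

even⇒xor : ∀ a b c → (⟦ a ⟧ + (⟦ b ⟧ + (⟦ c ⟧ + 0))) % 2 ≡ 0 → c ≡ a xor b
even⇒xor true  true  false _ = refl
even⇒xor true  false true  _ = refl
even⇒xor false true  true  _ = refl
even⇒xor false false false _ = refl

record Enumeration {n} (p : Subset n) (k : ℕ) : Set where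
  field
    at           : Fin k → Fin n
    at-injective : ∀ {i j} → at i ≡ at j → i ≡ j
    at-∈         : ∀ i → at i ∈ p
    ∈-at         : ∀ {x} → x ∈ p → Σ (Fin k) λ i → x ≡ at i

enumerate : ∀ {n} (p : Subset n) → Enumeration p ∣ p ∣
enumerate [] = record { at = λ () ; at-injective = λ { {()} } ; at-∈ = λ () ; ∈-at = λ () }
enumerate (true ∷ p) = record { at = at′ ; at-injective = injective ; at-∈ = member ; ∈-at = cover }
  where
  open Enumeration (enumerate p)
  at′ : Fin (suc ∣ p ∣) → Fin _
  at′ zero    = zero
  at′ (suc i) = suc (at i)
  injective : ∀ {i j} → at′ i ≡ at′ j → i ≡ j
  injective {zero}  {zero}  _  = refl
  injective {suc i} {suc j} eq = cong suc (at-injective (Fin.suc-injective eq))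
  member : ∀ i → at′ i ∈ true ∷ p
  member zero    = here
  member (suc i) = there (at-∈ i)
  cover : ∀ {x} → x ∈ true ∷ p → Σ _ λ i → x ≡ at′ i
  cover here       = zero , refl
  cover (there x∈) with ∈-at x∈
  ... | i , refl = suc i , refl
enumerate (false ∷ p) = record
  { at = suc ∘ at ; at-injective = at-injective ∘ Fin.suc-injective ; at-∈ = there ∘ at-∈ ; ∈-at = cover }
  where
  open Enumeration (enumerate p)
  cover : ∀ {x} → x ∈ false ∷ p → Σ _ λ i → x ≡ suc (at i)
  cover (there x∈) with ∈-at x∈
  ... | i , refl = i , refl

enumerate-≡ : ∀ {n k} (p : Subset n) → ∣ p ∣ ≡ k → Enumeration p k
enumerate-≡ p refl = enumerate p

bipartite-regular-balanced : ∀ {n d} (Γ : Graph n) (U : Subset n) → IsBipartition Γ U →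
  (∀ v → ∣ N Γ v ∣ ≡ suc d) → ∣ U ∣ ≡ ∣ ∁ U ∣
bipartite-regular-balanced {n} {d} Γ U bipartite regular = *-cancelʳ-≡ ∣ U ∣ ∣ ∁ U ∣ (suc d) (begin
  ∣ U ∣ * suc d                        ≡⟨ cong (_* suc d) (∣p∣≡∑ U) ⟩
  (∑[ i < n ] ⟦ u i ⟧) * suc d         ≡⟨ *-distribʳ-sum (suc d) (⟦_⟧ ∘ u) ⟩
  ∑[ i < n ] (⟦ u i ⟧ * suc d)         ≡⟨ sum-cong-≗ (λ i → sym (row i)) ⟩
  ∑[ i < n ] ∑[ j < n ] A i j          ≡⟨ ∑-comm A ⟩
  ∑[ j < n ] ∑[ i < n ] A i j          ≡⟨ sum-cong-≗ column ⟩
  ∑[ j < n ] (⟦ not (u j) ⟧ * suc d)   ≡⟨ sym (*-distribʳ-sum (suc d) (λ j → ⟦ not (u j) ⟧)) ⟩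
  (∑[ j < n ] ⟦ not (u j) ⟧) * suc d   ≡⟨ cong (_* suc d) (sym ∣∁U∣≡∑) ⟩
  ∣ ∁ U ∣ * suc d                      ∎)
  where
  open ≡-Reasoning
  u = lookup U
  A : Fin n → Fin n → ℕ
  A i j = ⟦ u i ∧ adj Γ i j ⟧
  degree : ∀ v → ∑[ j < n ] ⟦ adj Γ v j ⟧ ≡ suc d
  degree v = trans (sym (∣tabulate∣≡∑ (adj Γ v))) (regular v)
  row : ∀ i → ∑[ j < n ] A i j ≡ ⟦ u i ⟧ * suc d
  row i with u i
  ... | true  = trans (degree i) (sym (+-identityʳ (suc d)))
  ... | false = sum-replicate-zero n
  column : ∀ j → ∑[ i < n ] A i j ≡ ⟦ not (u j) ⟧ * suc d
  column j with u j in uj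
  ... | true  = trans (sum-cong-≗ no-edge) (sum-replicate-zero n)
    where
    no-edge : ∀ i → A i j ≡ 0
    no-edge i with u i in ui | adj Γ i j in ij
    ... | false | _     = refl
    ... | true  | false = refl
    ... | true  | true  with () ← trans (sym ui) (trans (bipartite i j ij) (cong not uj))
  ... | false = trans (sum-cong-≗ edge) (trans (degree j) (sym (+-identityʳ (suc d))))
    where
    edge : ∀ i → A i j ≡ ⟦ adj Γ j i ⟧
    edge i with u i in ui | adj Γ i j in ij
    ... | true  | _     = cong ⟦_⟧ (trans (sym ij) (adj-sym Γ i j))
    ... | false | false = cong ⟦_⟧ (trans (sym ij) (adj-sym Γ i j))
    ... | false | true  with () ← trans (sym ui) (trans (bipartite i j ij) (cong not uj))
  ∣∁U∣≡∑ : ∣ ∁ U ∣ ≡ ∑[ j < n ] ⟦ not (u j) ⟧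
  ∣∁U∣≡∑ = trans (∣p∣≡∑ (∁ U)) (sum-cong-≗ λ j → cong ⟦_⟧ (lookup-map j not U))

cubic-bipartite-order : ∀ {n} (Γ : Graph n) (U : Subset n) → IsBipartition Γ U → IsCubic Γ →
  n ≡ 2 * ∣ U ∣
cubic-bipartite-order {n} Γ U bipartite cubic = begin
  n                     ≡⟨ sym (m+[n∸m]≡n (∣p∣≤n U)) ⟩
  ∣ U ∣ + (n ∸ ∣ U ∣)   ≡⟨ cong (∣ U ∣ +_) (sym (∣∁p∣≡n∸∣p∣ U)) ⟩
  ∣ U ∣ + ∣ ∁ U ∣       ≡⟨ cong (∣ U ∣ +_) (sym (bipartite-regular-balanced Γ U bipartite cubic)) ⟩
  ∣ U ∣ + ∣ U ∣         ≡⟨ cong (∣ U ∣ +_) (sym (+-identityʳ ∣ U ∣)) ⟩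
  2 * ∣ U ∣             ∎
  where open ≡-Reasoning

private
  toBool : Fin 2 → Bool
  toBool zero       = false
  toBool (suc zero) = true

  fromBool : Bool → Fin 2
  fromBool false = zero
  fromBool true  = suc zero

  toBool-fromBool : ∀ b → toBool (fromBool b) ≡ b
  toBool-fromBool false = refl
  toBool-fromBool true  = refl

  toBool-injective : ∀ {i j} → toBool i ≡ toBool j → i ≡ j
  toBool-injective {zero}     {zero}     _ = refl
  toBool-injective {suc zero} {suc zero} _ = refl
  toBool-injective {zero}     {suc zero} ()
  toBool-injective {suc zero} {zero}     ()

funToFin-cong : ∀ {m k} {g h : Fin m → Fin k} → g ≗ h → funToFin g ≡ funToFin h
funToFin-cong {zero}  g≗h = refl
funToFin-cong {suc m} g≗h = cong₂ combine (g≗h zero) (funToFin-cong (g≗h ∘ suc))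

HasExactly-2^ : ∀ {A : Set} {k} (P : (A → Bool) → Set) (φ : (Fin k → Bool) → A → Bool) →
  (∀ c → P (φ c)) →
  (∀ {c c'} → c ≗ c' → φ c ≗ φ c') →
  (∀ {c c'} → φ c ≗ φ c' → c ≗ c') →
  (∀ M → P M → Σ (Fin k → Bool) λ c → M ≗ φ c) →
  HasExactly _≗_ P (2 ^ k)
HasExactly-2^ {k = k} P φ sound φ-cong φ-injective complete = tabulate (φ ∘ choice) , member , cover , distinct
  where
  choice : Fin (2 ^ k) → Fin k → Bool
  choice i = toBool ∘ finToFun i

  index : (Fin k → Bool) → Fin (2 ^ k)
  index c = funToFin (fromBool ∘ c)

  choice-index : ∀ c → choice (index c) ≗ c
  choice-index c x = trans (cong toBool (finToFun-funToFin (fromBool ∘ c) x)) (toBool-fromBool (c x))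

  entry : ∀ i → lookup (tabulate (φ ∘ choice)) i ≡ φ (choice i)
  entry = lookup∘tabulate (φ ∘ choice)

  member : ∀ i → P (lookup (tabulate (φ ∘ choice)) i)
  member i = subst P (sym (entry i)) (sound (choice i))

  cover : ∀ M → P M → Σ (Fin (2 ^ k)) λ i → M ≗ lookup (tabulate (φ ∘ choice)) i
  cover M PM with complete M PM
  ... | c , M≗φc = index c , λ a →
    trans (M≗φc a) (trans (φ-cong (sym ∘ choice-index c) a) (cong (λ g → g a) (sym (entry (index c)))))

  distinct : ∀ i j → lookup (tabulate (φ ∘ choice)) i ≗ lookup (tabulate (φ ∘ choice)) j → i ≡ j
  distinct i j Li≗Lj = begin
    i                             ≡⟨ sym (funToFin-finToFin {k} {2} i) ⟩
    funToFin (finToFun {2} {k} i) ≡⟨ funToFin-cong (λ x → toBool-injective (φ-injective φi≗φj x)) ⟩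
    funToFin (finToFun {2} {k} j) ≡⟨ funToFin-finToFin {k} {2} j ⟩
    j                             ∎
    where
    open ≡-Reasoning
    φi≗φj : φ (choice i) ≗ φ (choice j)
    φi≗φj a = trans (cong (λ g → g a) (sym (entry i))) (trans (Li≗Lj a) (cong (λ g → g a) (entry j)))

io-injective : ∀ {n} {v v' : Fin n} {S S' u u'} → io v S u ≡ io v' S' u' → (S ≡ S') × (u ≡ u')
io-injective refl = refl , refl

oo-select : ∀ {n} (M : EdgeSubset n) x y b → M (oo x y b) ≡ (if b then M (oo x y true) else M (oo x y false))
oo-select M x y true  = refl
oo-select M x y false = refl

module Stars {n} (Γ : Graph n) where

  Supported : EdgeSubset n → Set
  Supported M = ∀ e → M e ≡ true → ValidEdge Γ e

  unsupported : ∀ {M} → Supported M → ∀ {e} → ¬ ValidEdge Γ e → M e ≡ false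
  unsupported {M} supported {e} invalid with M e in Me
  ... | true  = ⊥-elim (invalid (supported e Me))
  ... | false = refl

  UniquelyMatched : EdgeSubset n → HVtx n → Set
  UniquelyMatched M x =
    Σ (HEdge n) λ e → (M e ≡ true) × Inc x e × (∀ e' → M e' ≡ true → Inc x e' → e' ≡ e)

  record Star (x : HVtx n) : Set where
    field
      edge           : Fin 3 → HEdge n
      edge-valid     : ∀ i → ValidEdge Γ (edge i)
      edge-incident  : ∀ i → Inc x (edge i)
      edge-onto      : ∀ e → ValidEdge Γ e → Inc x e → Σ (Fin 3) λ i → e ≡ edge i
      edge-injective : ∀ {i j} → edge i ≡ edge j → i ≡ j

  module _ {x} (star : Star x) {M} (supported : Supported M) where
    open Star star

    uniquelyMatched⇒exactlyOne : UniquelyMatched M x →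
      exactlyOne (M (edge 0F)) (M (edge 1F)) (M (edge 2F)) ≡ true
    uniquelyMatched⇒exactlyOne (e , Me , x∼e , unique) with edge-onto e (supported e Me) x∼e
    ... | i , refl = exactlyOne-complete (M ∘ edge) i
      (Me , λ j Mj → edge-injective (unique (edge j) Mj (edge-incident j)))

    exactlyOne⇒uniquelyMatched : exactlyOne (M (edge 0F)) (M (edge 1F)) (M (edge 2F)) ≡ true →
      UniquelyMatched M x
    exactlyOne⇒uniquelyMatched one with exactlyOne-sound (M ∘ edge) one
    ... | i , Mi , only = edge i , Mi , edge-incident i , λ e' Me' x∼e' →
      let j , e'≡ = edge-onto e' (supported e' Me') x∼e'
      in trans e'≡ (cong edge (only j (subst (λ e → M e ≡ true) e'≡ Me')))

-- The matchings of μ(F,f)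

module TwoFactorGadgets {n} (Γ : Graph n) (cubic : IsCubic Γ)
  (F : EdgeSet n) (twoFactor : IsTwoFactor Γ F) (f : Fin n → Fin n → Bool) where

  open Stars Γ

  F-sym : ∀ u v → F u v ≡ F v u
  F-sym = proj₁ twoFactor

  F⇒adj : ∀ {u v} → F u v ≡ true → adj Γ u v ≡ true
  F⇒adj = proj₁ (proj₂ twoFactor) _ _

  adj≢ : ∀ {u v} → adj Γ u v ≡ true → u ≢ v
  adj≢ {u} uv refl = bool-clash (adj-irrefl Γ u) uv

  ∣across∣≡1 : ∀ v → ∣ tabulate (λ x → adj Γ v x ∧ not (F v x)) ∣ ≡ 1
  ∣across∣≡1 v = suc-injective (suc-injective (begin
    2 + ∣ across ∣                                  ≡⟨ cong (_+ ∣ across ∣) (sym ∣F∣≡2) ⟩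
    ∣ tabulate (λ x → adj Γ v x ∧ F v x) ∣ + ∣ across ∣ ≡⟨ sym (∣tabulate∣-split (adj Γ v) (F v)) ⟩
    ∣ N Γ v ∣                                       ≡⟨ cubic v ⟩
    3                                               ∎))
    where
    open ≡-Reasoning
    across = tabulate (λ x → adj Γ v x ∧ not (F v x))
    along : ∀ x → F v x ≡ adj Γ v x ∧ F v x
    along x with F v x in vx
    ... | true  = sym (cong (_∧ true) (F⇒adj vx))
    ... | false = sym (∧-zeroʳ (adj Γ v x))
    ∣F∣≡2 : ∣ tabulate (λ x → adj Γ v x ∧ F v x) ∣ ≡ 2
    ∣F∣≡2 = trans (sym (∣tabulate∣-cong along)) (proj₂ (proj₂ twoFactor) v)

  private
    module Along  v = Enumeration (enumerate-≡ (tabulate (F v)) (proj₂ (proj₂ twoFactor) v))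
    module Across v = Enumeration (enumerate-≡ (tabulate (λ x → adj Γ v x ∧ not (F v x))) (∣across∣≡1 v))

  nbr : Fin n → Slot → Fin n
  nbr v 0F = Along.at v 0F
  nbr v 1F = Along.at v 1F
  nbr v 2F = Across.at v 0F

  F-nbr : ∀ v k → F v (nbr v k) ≡ inTwoFactor k
  F-nbr v 0F = ∈-tabulate⁻ (Along.at-∈ v 0F)
  F-nbr v 1F = ∈-tabulate⁻ (Along.at-∈ v 1F)
  F-nbr v 2F with F v (nbr v 2F) in r∈F
  ... | false = refl
  ... | true  = bool-clash (cong not r∈F)
                  (proj₂ (∧-elim {adj Γ v (nbr v 2F)} (∈-tabulate⁻ (Across.at-∈ v 0F))))

  adj-nbr : ∀ v k → adj Γ v (nbr v k) ≡ true
  adj-nbr v 0F = F⇒adj (F-nbr v 0F)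
  adj-nbr v 1F = F⇒adj (F-nbr v 1F)
  adj-nbr v 2F = proj₁ (∧-elim (∈-tabulate⁻ (Across.at-∈ v 0F)))

  nbr-injective : ∀ v {k k'} → nbr v k ≡ nbr v k' → k ≡ k'
  nbr-injective v {0F} {0F} _ = refl
  nbr-injective v {1F} {1F} _ = refl
  nbr-injective v {2F} {2F} _ = refl
  nbr-injective v {0F} {1F} e with () ← Along.at-injective v e
  nbr-injective v {1F} {0F} e with () ← Along.at-injective v e
  nbr-injective v {0F} {2F} e = bool-clash (trans (cong (F v) e) (F-nbr v 2F)) (F-nbr v 0F)
  nbr-injective v {1F} {2F} e = bool-clash (trans (cong (F v) e) (F-nbr v 2F)) (F-nbr v 1F)
  nbr-injective v {2F} {0F} e = bool-clash (trans (cong (F v) (sym e)) (F-nbr v 2F)) (F-nbr v 0F)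
  nbr-injective v {2F} {1F} e = bool-clash (trans (cong (F v) (sym e)) (F-nbr v 2F)) (F-nbr v 1F)

  nbr-onto : ∀ v {x} → adj Γ v x ≡ true → Σ Slot λ k → x ≡ nbr v k
  nbr-onto v {x} vx with F v x in F-vx
  ... | true with Along.∈-at v (∈-tabulate⁺ F-vx)
  ...   | 0F , x≡ = 0F , x≡
  ...   | 1F , x≡ = 1F , x≡
  nbr-onto v {x} vx | false with Across.∈-at v (∈-tabulate⁺ (∧-intro vx (cong not F-vx)))
  ...   | 0F , x≡ = 2F , x≡

  nbr-≟ : ∀ v k j → does (nbr v k ≟ nbr v j) ≡ does (k ≟ j)
  nbr-≟ v k j with k ≟ j
  ... | yes refl = dec-true (nbr v k ≟ nbr v k) refl
  ... | no k≢j   = dec-false (nbr v k ≟ nbr v j) (k≢j ∘ nbr-injective v)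

  orient : Fin n → Fin n → Fin n × Fin n
  orient v u with v <? u
  ... | yes _ = v , u
  ... | no  _ = u , v

  ooEdge : Fin n → Fin n → Bool → HEdge n
  ooEdge v u b = oo (proj₁ (orient v u)) (proj₂ (orient v u)) b

  f-edge : Fin n → Fin n → Bool
  f-edge v u = f (proj₁ (orient v u)) (proj₂ (orient v u))

  ooEdge-valid : ∀ {v u} b → adj Γ v u ≡ true → ValidEdge Γ (ooEdge v u b)
  ooEdge-valid {v} {u} b vu with v <? u
  ... | yes v<u = v<u , vu
  ... | no  v≮u with <-cmp v u
  ...   | tri< v<u _ _ = ⊥-elim (v≮u v<u)
  ...   | tri≈ _ v≡u _ = ⊥-elim (adj≢ vu v≡u)
  ...   | tri> _ _ u<v = u<v , trans (adj-sym Γ u v) vu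

  ooEdge-incident : ∀ v u b → Inc (outer v u b) (ooEdge v u b)
  ooEdge-incident v u b with v <? u
  ... | yes _ = refl , inj₁ (refl , refl)
  ... | no  _ = refl , inj₂ (refl , refl)

  oo-incident : ∀ {v u b x y b'} → x < y → Inc (outer v u b) (oo x y b') → oo x y b' ≡ ooEdge v u b
  oo-incident {v} {u} x<y (refl , inj₁ (refl , refl)) with v <? u
  ... | yes _   = refl
  ... | no  v≮u = ⊥-elim (v≮u x<y)
  oo-incident {v} {u} x<y (refl , inj₂ (refl , refl)) with v <? u
  ... | yes v<u = ⊥-elim (<-asym v<u x<y)
  ... | no  _   = refl

  ooEdge≢io : ∀ {v u b w S x} → ooEdge v u b ≢ io w S x
  ooEdge≢io {v} {u} with v <? u
  ... | yes _ = λ ()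
  ... | no  _ = λ ()

  ooValue : Fin n → Fin n → Bool → Bool
  ooValue x y b = does (x <? y) ∧ F x y ∧ (b ≡ᵇ f x y)

  Prescribed : EdgeSubset n → Set
  Prescribed M = ∀ x y b → M (oo x y b) ≡ ooValue x y b

  prescribed-ooEdge : ∀ {M} → Prescribed M → ∀ {v u} b → adj Γ v u ≡ true →
    M (ooEdge v u b) ≡ F v u ∧ (b ≡ᵇ f-edge v u)
  prescribed-ooEdge {M} prescribed {v} {u} b vu with v <? u | ooEdge-valid {v} {u} b vu
  ... | yes _ | v<u , _ = trans (prescribed v u b) (cong (λ d → d ∧ F v u ∧ (b ≡ᵇ f v u)) (dec-true (v <? u) v<u))
  ... | no  _ | u<v , _ = begin
    M (oo u v b)
      ≡⟨ prescribed u v b ⟩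
    does (u <? v) ∧ F u v ∧ (b ≡ᵇ f u v)
      ≡⟨ cong₂ (λ d g → d ∧ g ∧ (b ≡ᵇ f u v)) (dec-true (u <? v) u<v) (F-sym u v) ⟩
    F v u ∧ (b ≡ᵇ f u v) ∎
    where open ≡-Reasoning

  f-slot : Fin n → Slot → Bool
  f-slot v k = f-edge v (nbr v k)

  -- The inner vertex with coordinates (α , β) of the gadget at v: at slots 0F and 1F its bit differs
  -- from the bit f-slot v k of the copy of the F-edge in the matching exactly when it is adjacent to
  -- the free outer vertex there; its bit at 2F is forced by evenness.
  innerBits : Fin n → Bool × Bool → Slot → Bool
  innerBits v (α , β) 0F = α xor f-slot v 0F
  innerBits v (α , β) 1F = β xor f-slot v 1F
  innerBits v (α , β) 2F = (α xor f-slot v 0F) xor (β xor f-slot v 1F)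

  fromSlots : Fin n → (Slot → Bool) → Fin n → Bool
  fromSlots v σ x with any? (λ k → x ≟ nbr v k)
  ... | yes (k , _) = σ k
  ... | no  _       = false

  fromSlots-nbr : ∀ v σ k → fromSlots v σ (nbr v k) ≡ σ k
  fromSlots-nbr v σ k with any? (λ j → nbr v k ≟ nbr v j)
  ... | yes (j , k≡j) = cong σ (sym (nbr-injective v k≡j))
  ... | no  ∄j        = ⊥-elim (∄j (k , refl))

  fromSlots-support : ∀ v σ x → fromSlots v σ x ≡ true → Σ Slot λ k → x ≡ nbr v k
  fromSlots-support v σ x σx with any? (λ k → x ≟ nbr v k)
  ... | yes k,x≡ = k,x≡

  innerSet : Fin n → Bool × Bool → Subset n
  innerSet v i = tabulate (fromSlots v (innerBits v i))

  lookup-innerSet : ∀ v i k → lookup (innerSet v i) (nbr v k) ≡ innerBits v i k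
  lookup-innerSet v i k = trans (lookup∘tabulate _ (nbr v k)) (fromSlots-nbr v (innerBits v i) k)

  ∈N-nbr : ∀ v k → nbr v k ∈ N Γ v
  ∈N-nbr v k = ∈-tabulate⁺ (adj-nbr v k)

  ∣∣≡slot-bits : ∀ v (S : Subset n) → (∀ {x} → x ∈ S → adj Γ v x ≡ true) →
    ∣ S ∣ ≡ ⟦ lookup S (nbr v 0F) ⟧ + (⟦ lookup S (nbr v 1F) ⟧ + (⟦ lookup S (nbr v 2F) ⟧ + 0))
  ∣∣≡slot-bits v S S⊆adj = trans (cong ∣_∣ (sym (tabulate∘lookup S)))
    (∣tabulate∣-image (lookup S) (nbr v) (nbr-injective v)
      λ x Sx → nbr-onto v (S⊆adj (lookup⇒[]= x S Sx)))

  innerSet-valid : ∀ v i → ValidVtx Γ (inner v (innerSet v i))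
  innerSet-valid v (α , β) = ⊆N , even
    where
    ⊆adj : ∀ {x} → x ∈ innerSet v (α , β) → adj Γ v x ≡ true
    ⊆adj {x} x∈ with fromSlots-support v (innerBits v (α , β)) x (∈-tabulate⁻ x∈)
    ... | k , refl = adj-nbr v k
    ⊆N : innerSet v (α , β) ⊆ N Γ v
    ⊆N = ∈-tabulate⁺ ∘ ⊆adj
    even : ∣ innerSet v (α , β) ∣ % 2 ≡ 0
    even rewrite ∣∣≡slot-bits v (innerSet v (α , β)) ⊆adj
               | lookup-innerSet v (α , β) 0F | lookup-innerSet v (α , β) 1F | lookup-innerSet v (α , β) 2F
      = xor-even (α xor f-slot v 0F) (β xor f-slot v 1F)

  valid-parity : ∀ {v S} → ValidVtx Γ (inner v S) →
    lookup S (nbr v 2F) ≡ lookup S (nbr v 0F) xor lookup S (nbr v 1F)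
  valid-parity {v} {S} (S⊆N , even) =
    even⇒xor (lookup S (nbr v 0F)) (lookup S (nbr v 1F)) _
      (subst (λ m → m % 2 ≡ 0) (∣∣≡slot-bits v S (∈-tabulate⁻ ∘ S⊆N)) even)

  innerCoords : Fin n → Subset n → Bool × Bool
  innerCoords v S = lookup S (nbr v 0F) xor f-slot v 0F , lookup S (nbr v 1F) xor f-slot v 1F

  innerCoords-innerSet : ∀ v i → innerCoords v (innerSet v i) ≡ i
  innerCoords-innerSet v (α , β) = cong₂ _,_
    (trans (cong (_xor f-slot v 0F) (lookup-innerSet v (α , β) 0F)) (xor-cancelʳ α (f-slot v 0F)))
    (trans (cong (_xor f-slot v 1F) (lookup-innerSet v (α , β) 1F)) (xor-cancelʳ β (f-slot v 1F)))

  innerSet-innerCoords : ∀ {v S} → ValidVtx Γ (inner v S) → S ≡ innerSet v (innerCoords v S)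
  innerSet-innerCoords {v} {S} valid@(S⊆N , _) = trans (sym (tabulate∘lookup S)) (tabulate-cong pointwise)
    where
    pointwise : ∀ x → lookup S x ≡ fromSlots v (innerBits v (innerCoords v S)) x
    pointwise x with any? (λ k → x ≟ nbr v k)
    ... | yes (0F , refl) = sym (xor-cancelʳ _ _)
    ... | yes (1F , refl) = sym (xor-cancelʳ _ _)
    ... | yes (2F , refl) = trans (valid-parity valid) (sym (cong₂ _xor_
      (xor-cancelʳ (lookup S (nbr v 0F)) (f-slot v 0F)) (xor-cancelʳ (lookup S (nbr v 1F)) (f-slot v 1F))))
    ... | no  ∄k with lookup S x in Sx
    ...   | false = refl
    ...   | true  = ⊥-elim (∄k (nbr-onto v (∈-tabulate⁻ (S⊆N (lookup⇒[]= x S Sx)))))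

  innerStar : ∀ v S → ValidVtx Γ (inner v S) → Star (inner v S)
  innerStar v S valid = record
    { edge           = io v S ∘ nbr v
    ; edge-valid     = λ k → valid , ∈N-nbr v k
    ; edge-incident  = λ k → refl , refl
    ; edge-onto      = onto
    ; edge-injective = λ e → nbr-injective v (proj₂ (io-injective e))
    }
    where
    onto : ∀ e → ValidEdge Γ e → Inc (inner v S) e → Σ Slot λ k → e ≡ io v S (nbr v k)
    onto (io v S u) (_ , u∈N) (refl , refl) with nbr-onto v (∈-tabulate⁻ u∈N)
    ... | k , refl = k , refl

  offset : Fin n → Slot → Bool
  offset v 0F = f-slot v 0F
  offset v 1F = f-slot v 1F
  offset v 2F = f-slot v 0F xor f-slot v 1F

  -- The coordinate, in the sense of outerNbr, of the outer vertex (v , nbr v k , b).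
  outerCoord : Fin n → Slot → Bool → Bool
  outerCoord v k b = b xor offset v k

  outerIo : Fin n → Slot → Bool → Bool → HEdge n
  outerIo v k b s = io v (innerSet v (outerNbr k (outerCoord v k b) s)) (nbr v k)

  lookup-outerNbr : ∀ v k b s → lookup (innerSet v (outerNbr k (outerCoord v k b) s)) (nbr v k) ≡ b
  lookup-outerNbr v k b s = trans (lookup-innerSet v (outerNbr k (outerCoord v k b) s) k) (bits k)
    where
    bits : ∀ k → innerBits v (outerNbr k (outerCoord v k b) s) k ≡ b
    bits 0F = xor-cancelʳ b (f-slot v 0F)
    bits 1F = xor-cancelʳ b (f-slot v 1F)
    bits 2F = ≡ᵇ-sound (tautology-sound 4
      (λ s b f₀ f₁ → ((s xor f₀) xor ((s xor (b xor (f₀ xor f₁))) xor f₁)) ≡ᵇ b) refl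
      s b (f-slot v 0F) (f-slot v 1F))

  innerCoords-outerNbr : ∀ {v S} k {b} → ValidVtx Γ (inner v S) → lookup S (nbr v k) ≡ b →
    Σ Bool λ s → innerCoords v S ≡ outerNbr k (outerCoord v k b) s
  innerCoords-outerNbr {v} {S} 0F valid refl = _ , refl
  innerCoords-outerNbr {v} {S} 1F valid refl = _ , refl
  innerCoords-outerNbr {v} {S} 2F valid refl = _ , cong (proj₁ (innerCoords v S) ,_) (begin
    S₁ xor f₁
      ≡⟨ ≡ᵇ-sound (tautology-sound 4
           (λ S₀ S₁ f₀ f₁ → (S₁ xor f₁) ≡ᵇ ((S₀ xor f₀) xor ((S₀ xor S₁) xor (f₀ xor f₁)))) refl S₀ S₁ f₀ f₁) ⟩
    (S₀ xor f₀) xor ((S₀ xor S₁) xor (f₀ xor f₁))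
      ≡⟨ cong (λ b → (S₀ xor f₀) xor (b xor (f₀ xor f₁))) (sym (valid-parity valid)) ⟩
    (S₀ xor f₀) xor (lookup S (nbr v 2F) xor (f₀ xor f₁)) ∎)
    where
    open ≡-Reasoning
    S₀ = lookup S (nbr v 0F)
    S₁ = lookup S (nbr v 1F)
    f₀ = f-slot v 0F
    f₁ = f-slot v 1F

  outerIo-injective : ∀ {v k b s s'} → outerIo v k b s ≡ outerIo v k b s' → s ≡ s'
  outerIo-injective {v} {k} {b} {s} {s'} e = outerNbr-injective k (begin
    outerNbr k a s                              ≡⟨ sym (innerCoords-innerSet v (outerNbr k a s)) ⟩
    innerCoords v (innerSet v (outerNbr k a s))  ≡⟨ cong (innerCoords v) (proj₁ (io-injective e)) ⟩
    innerCoords v (innerSet v (outerNbr k a s')) ≡⟨ innerCoords-innerSet v (outerNbr k a s') ⟩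
    outerNbr k a s'                             ∎)
    where
    open ≡-Reasoning
    a = outerCoord v k b

  outerEdge : Fin n → Slot → Bool → Fin 3 → HEdge n
  outerEdge v k b 0F = ooEdge v (nbr v k) b
  outerEdge v k b 1F = outerIo v k b true
  outerEdge v k b 2F = outerIo v k b false

  outerStar : ∀ v k b → Star (outer v (nbr v k) b)
  outerStar v k b = record
    { edge           = outerEdge v k b
    ; edge-valid     = valid
    ; edge-incident  = incident
    ; edge-onto      = onto
    ; edge-injective = injective
    }
    where
    valid : ∀ i → ValidEdge Γ (outerEdge v k b i)
    valid 0F = ooEdge-valid b (adj-nbr v k)
    valid 1F = innerSet-valid v _ , ∈N-nbr v k
    valid 2F = innerSet-valid v _ , ∈N-nbr v k
    incident : ∀ i → Inc (outer v (nbr v k) b) (outerEdge v k b i)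
    incident 0F = ooEdge-incident v (nbr v k) b
    incident 1F = refl , refl , lookup-outerNbr v k b true
    incident 2F = refl , refl , lookup-outerNbr v k b false
    io≡outerIo : ∀ {S s} → ValidVtx Γ (inner v S) → innerCoords v S ≡ outerNbr k (outerCoord v k b) s →
      io v S (nbr v k) ≡ outerIo v k b s
    io≡outerIo valid coords≡ =
      cong (λ S → io v S (nbr v k)) (trans (innerSet-innerCoords valid) (cong (innerSet v) coords≡))
    onto : ∀ e → ValidEdge Γ e → Inc (outer v (nbr v k) b) e → Σ (Fin 3) λ i → e ≡ outerEdge v k b i
    onto (oo x y b') (x<y , _) v∼e = 0F , oo-incident x<y v∼e
    onto (io v S _) (valid , _) (refl , refl , Sb) with innerCoords-outerNbr k valid Sb
    ... | true  , coords≡ = 1F , io≡outerIo valid coords≡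
    ... | false , coords≡ = 2F , io≡outerIo valid coords≡
    injective : ∀ {i j} → outerEdge v k b i ≡ outerEdge v k b j → i ≡ j
    injective {0F} {0F} _ = refl
    injective {1F} {1F} _ = refl
    injective {2F} {2F} _ = refl
    injective {0F} {1F} e = ⊥-elim (ooEdge≢io {v} {nbr v k} {b} e)
    injective {0F} {2F} e = ⊥-elim (ooEdge≢io {v} {nbr v k} {b} e)
    injective {1F} {0F} e = ⊥-elim (ooEdge≢io {v} {nbr v k} {b} (sym e))
    injective {2F} {0F} e = ⊥-elim (ooEdge≢io {v} {nbr v k} {b} (sym e))
    injective {1F} {2F} e with () ← outerIo-injective {v} {k} {b} e
    injective {2F} {1F} e with () ← outerIo-injective {v} {k} {b} e

  table : EdgeSubset n → Fin n → Table
  table M v i k = M (io v (innerSet v i) (nbr v k))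

  prescribed-outer : ∀ {M} → Prescribed M → ∀ v k b →
    M (ooEdge v (nbr v k) b) ≡ inTwoFactor k ∧ not (outerCoord v k b)
  prescribed-outer {M} prescribed v k b =
    trans (prescribed-ooEdge {M} prescribed {v} {nbr v k} b (adj-nbr v k)) (slot k)
    where
    slot : ∀ k → F v (nbr v k) ∧ (b ≡ᵇ f-edge v (nbr v k)) ≡ inTwoFactor k ∧ not (outerCoord v k b)
    slot 0F = cong (_∧ not (outerCoord v 0F b)) (F-nbr v 0F)
    slot 1F = cong (_∧ not (outerCoord v 1F b)) (F-nbr v 1F)
    slot 2F rewrite F-nbr v 2F = refl

  module _ {M} (supported : Supported M) (prescribed : Prescribed M) where

    outerStar-exactlyOne : ∀ v k b →
      exactlyOne (M (outerEdge v k b 0F)) (M (outerEdge v k b 1F)) (M (outerEdge v k b 2F))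
        ≡ outerCond (table M v) k (outerCoord v k b)
    outerStar-exactlyOne v k b =
      cong (λ m → exactlyOne m (M (outerEdge v k b 1F)) (M (outerEdge v k b 2F)))
        (prescribed-outer {M} prescribed v k b)

    matched⇒gadgets : (∀ x → ValidVtx Γ x → UniquelyMatched M x) → ∀ v → IsGadgetMatching (table M v)
    matched⇒gadgets matched v = record { at-inner = inner′ ; at-outer = outer′ }
      where
      inner′ : ∀ i → innerCond (table M v) i ≡ true
      inner′ i = uniquelyMatched⇒exactlyOne (innerStar v (innerSet v i) (innerSet-valid v i)) supported
        (matched (inner v (innerSet v i)) (innerSet-valid v i))
      outer′ : ∀ k a → outerCond (table M v) k a ≡ true
      outer′ k a = subst (λ a → outerCond (table M v) k a ≡ true) (xor-cancelʳ a (offset v k))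
        (trans (sym (outerStar-exactlyOne v k b))
          (uniquelyMatched⇒exactlyOne (outerStar v k b) supported (matched (outer v (nbr v k) b) (∈N-nbr v k))))
        where b = a xor offset v k

    gadgets⇒matched : (∀ v → IsGadgetMatching (table M v)) → ∀ x → ValidVtx Γ x → UniquelyMatched M x
    gadgets⇒matched gadgets (inner v S) valid =
      subst (UniquelyMatched M ∘ inner v) (sym (innerSet-innerCoords valid))
        (exactlyOne⇒uniquelyMatched (innerStar v (innerSet v i) (innerSet-valid v i)) supported
          (IsGadgetMatching.at-inner (gadgets v) i))
      where i = innerCoords v S
    gadgets⇒matched gadgets (outer v u b) u∈N with nbr-onto v (∈-tabulate⁻ u∈N)
    ... | k , refl = exactlyOne⇒uniquelyMatched (outerStar v k b) supported
      (trans (outerStar-exactlyOne v k b) (IsGadgetMatching.at-outer (gadgets v) k (outerCoord v k b)))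

  validIo? : ∀ v S u → Dec (ValidEdge Γ (io v S u))
  validIo? v S u = ((S ⊆? N Γ v) ×-dec (∣ S ∣ % 2 ℕ.≟ 0)) ×-dec (u ∈? N Γ v)

  matching : (Fin n → Bool) → EdgeSubset n
  matching c (oo x y b) = ooValue x y b
  matching c (io v S u) = does (validIo? v S u) ∧ does (u ≟ nbr v (partner (c v) (innerCoords v S)))

  table-matching : ∀ c v i k → table (matching c) v i k ≡ gadget (c v) i k
  table-matching c v i k = begin
    does (validIo? v (innerSet v i) (nbr v k))
      ∧ does (nbr v k ≟ nbr v (partner (c v) (innerCoords v (innerSet v i))))
      ≡⟨ cong₂ _∧_ (dec-true (validIo? v (innerSet v i) (nbr v k)) (innerSet-valid v i , ∈N-nbr v k))
                   (cong (λ j → does (nbr v k ≟ nbr v (partner (c v) j))) (innerCoords-innerSet v i)) ⟩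
    does (nbr v k ≟ nbr v (partner (c v) i))
      ≡⟨ nbr-≟ v k (partner (c v) i) ⟩
    gadget (c v) i k ∎
    where open ≡-Reasoning

  matching-supported : ∀ c → Supported (matching c)
  matching-supported c (oo x y b) h =
    from-does (x <? y) (proj₁ (∧-elim h)) , F⇒adj (proj₁ (∧-elim (proj₂ (∧-elim {does (x <? y)} h))))
  matching-supported c (io v S u) h = from-does (validIo? v S u) (proj₁ (∧-elim h))

  ooValue-xor : ∀ {x y} → x < y → ooValue x y false xor ooValue x y true ≡ F x y
  ooValue-xor {x} {y} x<y rewrite dec-true (x <? y) x<y with F x y | f x y
  ... | true  | true  = refl
  ... | true  | false = refl
  ... | false | _     = refl

  matching-inMu : ∀ c → InMu Γ F f (matching c)
  matching-inMu c =
    (matching-supported c , gadgets⇒matched (matching-supported c) (λ _ _ _ → refl) gadgets) ,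
    uniform ,
    (λ x y x<y _ → (λ h → trans (sym (ooValue-xor x<y)) h) , (λ h → trans (ooValue-xor x<y) h)) ,
    chosen
    where
    gadgets : ∀ v → IsGadgetMatching (table (matching c) v)
    gadgets v = IsGadgetMatching-resp (λ i k → sym (table-matching c v i k)) (gadget-isGadgetMatching (c v))
    uniform : IsUniform Γ (matching c)
    uniform x y x<y _ (m₀ , m₁) rewrite dec-true (x <? y) x<y with F x y
    ... | true  = bool-clash (sym (≡ᵇ-sound m₀)) (sym (≡ᵇ-sound m₁))
    chosen : ∀ x y → x < y → F x y ≡ true → ooValue x y (f x y) ≡ true
    chosen x y x<y Fxy rewrite dec-true (x <? y) x<y | Fxy = cong not (xor-same (f x y))

  prescribed-of-InMu : ∀ {M} → InMu Γ F f M → Prescribed M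
  prescribed-of-InMu {M} ((supported , _) , uniform , inF , chosen) x y b with x <? y
  ... | no x≮y = trans (unsupported supported (x≮y ∘ proj₁))
                       (sym (cong (λ d → d ∧ F x y ∧ (b ≡ᵇ f x y)) (dec-false (x <? y) x≮y)))
  ... | yes x<y rewrite dec-true (x <? y) x<y | oo-select M x y b with adj Γ x y in xy | F x y in Fxy
  ...   | false | true  = bool-clash xy (F⇒adj Fxy)
  ...   | false | false = trans (sym (oo-select M x y b)) (unsupported supported (λ (_ , xy′) → bool-clash xy xy′))
  ...   | true  | true  = xor-select _ _ (f x y) b (proj₂ (inF x y x<y xy) Fxy)
                            (trans (sym (oo-select M x y (f x y))) (chosen x y x<y Fxy))
  ...   | true  | false = xor-neither _ _ b (λ one → bool-clash Fxy (proj₁ (inF x y x<y xy) one))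
                                            (uniform x y x<y xy)

  matching-complete : ∀ M → InMu Γ F f M → Σ (Fin n → Bool) λ c → M ≗ matching c
  matching-complete M inMu@((supported , matched) , _) = c , agree
    where
    prescribed = prescribed-of-InMu inMu
    gadgets = matched⇒gadgets supported prescribed matched
    c : Fin n → Bool
    c v = table M v (true , true) 1F
    agree : M ≗ matching c
    agree (oo x y b) = prescribed x y b
    agree (io v S u) with validIo? v S u
    ... | no invalid = trans (unsupported supported invalid) (sym (cong (_∧ does (u ≟ nbr v (partner (c v) i)))
                                                                   (dec-false (validIo? v S u) invalid)))
      where i = innerCoords v S
    ... | yes (valid , u∈N) with nbr-onto v (∈-tabulate⁻ u∈N)
    ...   | k , refl = begin
      M (io v S (nbr v k))            ≡⟨ cong (λ S → M (io v S (nbr v k))) S≡ ⟩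
      table M v i k                   ≡⟨ gadget-rigid (table M v) (gadgets v) i k ⟩
      gadget (c v) i k                ≡⟨ sym (table-matching c v i k) ⟩
      table (matching c) v i k        ≡⟨ cong (λ S → matching c (io v S (nbr v k))) (sym S≡) ⟩
      matching c (io v S (nbr v k))   ∎
      where
      open ≡-Reasoning
      i  = innerCoords v S
      S≡ = innerSet-innerCoords valid

  matching-injective : ∀ {c c'} → matching c ≗ matching c' → c ≗ c'
  matching-injective {c} {c'} same v = begin
    c v                                       ≡⟨ sym (gadget-choice (c v)) ⟩
    gadget (c v) (true , true) 1F             ≡⟨ sym (table-matching c v (true , true) 1F) ⟩
    table (matching c) v (true , true) 1F     ≡⟨ same (io v (innerSet v (true , true)) (nbr v 1F)) ⟩
    table (matching c') v (true , true) 1F    ≡⟨ table-matching c' v (true , true) 1F ⟩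
    gadget (c' v) (true , true) 1F            ≡⟨ gadget-choice (c' v) ⟩
    c' v                                      ∎
    where open ≡-Reasoning

  matching-cong : ∀ {c c'} → c ≗ c' → matching c ≗ matching c'
  matching-cong c≗c' (oo x y b) = refl
  matching-cong c≗c' (io v S u) =
    cong (λ cv → does (validIo? v S u) ∧ does (u ≟ nbr v (partner cv (innerCoords v S)))) (c≗c' v)

mainTheorem3 : ∀ {n} (Γ : Graph n) (U : Subset n) → IsBipartition Γ U → IsCubic Γ →
    (F : EdgeSet n) → IsTwoFactor Γ F → (f : Fin n → Fin n → Bool) →
    HasExactly _≗_ (InMu Γ F f) (2 ^ (2 * ∣ U ∣))
mainTheorem3 Γ U bipartite cubic F twoFactor f =
  subst (HasExactly _≗_ (InMu Γ F f)) (cong (2 ^_) (cubic-bipartite-order Γ U bipartite cubic))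
    (HasExactly-2^ (InMu Γ F f) matching matching-inMu matching-cong matching-injective matching-complete)
  where open TwoFactorGadgets Γ cubic F twoFactor f
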